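{- Let $G$ be a graph with domination number $\gamma$. Then for all $\alpha\in(0,1)$, $\mathrm{pd}_\alpha(G)+\mathrm{pd}_{1-\alpha}(G)\le \gamma+1$.
   Context: All graphs are finite and simple. For a graph $G=(V,E)$ and $S\subseteq V$, $N[S]$ denotes the closed neighbourhood of $S$. For $0<\alpha\le 1$, a set $S\subseteq V$ is an $\alpha$-partial dominating set if $|N[S]|\ge \alpha|V|$; $\mathrm{pd}_\alpha(G)$ is the minimum size of an $\alpha$-partial dominating set. $\gamma$ denotes the domination number.
   Formalization: The parameter α ranges over the rationals in the interval $(0,1)$. -}

module Defs where

open import Data.Nat using (ℕ) renaming (_≤_ to _≤ℕ_)
open import Data.Integer using (+_)
open import Data.Bool using (Bool; false; T)
open import Data.Fin using (Fin)
open import Data.Fin.Subset using (Subset; ∣_∣; _∈_)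
open import Data.Product using (∃; _×_)
open import Data.Sum using (_⊎_)
open import Data.Rational using (ℚ; _/_; _*_; _≤_)
open import Relation.Binary.PropositionalEquality using (_≡_)

record Graph (n : ℕ) : Set where
  field
    adj    : Fin n → Fin n → Bool
    sym    : ∀ u v → adj u v ≡ adj v u
    irrefl : ∀ v → adj v v ≡ false

open Graph public

ℕ→ℚ : ℕ → ℚ
ℕ→ℚ k = + k / 1

InClosedNbhd : {n : ℕ} → Graph n → Subset n → Fin n → Set
InClosedNbhd G S v = v ∈ S ⊎ ∃ λ u → u ∈ S × T (adj G u v)

IsClosedNbhd : {n : ℕ} → Graph n → Subset n → Subset n → Set
IsClosedNbhd G S W = ∀ v → (v ∈ W → InClosedNbhd G S v) × (InClosedNbhd G S v → v ∈ W)

IsPartialDom : {n : ℕ} → ℚ → Graph n → Subset n → Set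
IsPartialDom {n} α G S = ∃ λ W → IsClosedNbhd G S W × (α * ℕ→ℚ n ≤ ℕ→ℚ ∣ W ∣)

IsDominating : {n : ℕ} → Graph n → Subset n → Set
IsDominating G S = ∀ v → InClosedNbhd G S v

IsPd : {n : ℕ} → ℚ → Graph n → ℕ → Set
IsPd α G k = (∃ λ S → IsPartialDom α G S × ∣ S ∣ ≡ k)
           × (∀ S → IsPartialDom α G S → k ≤ℕ ∣ S ∣)

IsDomNumber : {n : ℕ} → Graph n → ℕ → Set
IsDomNumber G k = (∃ λ S → IsDominating G S × ∣ S ∣ ≡ k)
                × (∀ S → IsDominating G S → k ≤ℕ ∣ S ∣)

-- Fix a minimum dominating set D, |D| = γ, and order its elements by
-- vertex index; D_j is the set of its first j elements and D^j = D ∖ D_j.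
-- Since N[D] = V, some prefix reaches |N[D_j]| ≥ αn.  Take the first such
-- index.  If it is 0, then ∅ is α-partial dominating and D is
-- (1-α)-partial dominating.  Otherwise there is j with |N[D_j]| < αn ≤
-- |N[D_{j+1}]|; since N[D_j] ∪ N[D^j] = N[D] = V we get
-- |N[D^j]| ≥ n - |N[D_j]| > (1-α)n.  So D_{j+1} is α-partial dominating,
-- D^j is (1-α)-partial dominating, and |D_{j+1}| + |D^j| ≤ |D| + 1.
module Submission where

open import Defs
open import Data.Nat using (ℕ; _+_; _≤_)
open import Data.Rational using (ℚ; _-_; _<_; 0ℚ; 1ℚ)

open import Data.Nat using (zero; suc; z≤n; s≤s; _∸_)
import Data.Nat.Properties as ℕP
open import Data.Integer using (+_)
import Data.Integer.Properties as ℤP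
import Data.Nat.Coprimality as Coprime
open import Data.Rational using (mkℚ; _*_; -_)
  renaming (_+_ to _+ℚ_; _≤_ to _≤ℚ_; _≤?_ to _≤ℚ?_)
import Data.Rational.Properties as ℚP
open import Data.Bool using (T?)
open import Data.Fin.Properties using (any?)
open import Data.Fin.Subset using (Subset; ∣_∣; _∈_; _∪_; ⊥; ⊤; inside; outside)
open import Data.Fin.Subset.Properties
  using (_∈?_; ∣⊥∣≡0; ∣⊤∣≡n; ∣p∣≤∣x∷p∣; p⊆q⇒∣p∣≤∣q∣; x∈p∪q⁺)
open import Data.Vec using ([]; _∷_; lookup; tabulate; here; there)
open import Data.Vec.Properties using ([]=⇒lookup; lookup⇒[]=; lookup∘tabulate)
open import Data.Product using (∃; ∃₂; _×_; _,_; proj₂)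
open import Data.Sum using (_⊎_; inj₁; inj₂; [_,_])
import Data.Sum as Sum
open import Relation.Nullary using (Dec; yes; no; does; ¬_)
open import Relation.Nullary.Decidable using (_×-dec_; _⊎-dec_; toWitness; isYes≗does; dec-true)
open import Data.Bool.Properties using (T-≡)
open import Function.Bundles using (Equivalence)
open import Relation.Binary.PropositionalEquality
  using (_≡_; refl; trans; cong; cong₂; subst; module ≡-Reasoning)
  renaming (sym to ≡-sym)

ℕ→ℚ≡mkℚ : ∀ k → ℕ→ℚ k ≡ mkℚ (+ k) 0 (Coprime.sym (Coprime.1-coprimeTo k))
ℕ→ℚ≡mkℚ k = ℚP.normalize-coprime (Coprime.sym (Coprime.1-coprimeTo k))

ℕ→ℚ-+ : ∀ m k → ℕ→ℚ (m + k) ≡ ℕ→ℚ m +ℚ ℕ→ℚ k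
ℕ→ℚ-+ m k rewrite ℕ→ℚ≡mkℚ m | ℕ→ℚ≡mkℚ k
                | ℤP.*-identityʳ (+ m) | ℤP.*-identityʳ (+ k) = refl

ℕ→ℚ-nonNeg : ∀ k → 0ℚ ≤ℚ ℕ→ℚ k
ℕ→ℚ-nonNeg k = ℚP.nonNegative⁻¹ (ℕ→ℚ k) {{ℚP.normalize-nonNeg k 1}}

ℕ→ℚ-mono-≤ : ∀ {m k} → m ≤ k → ℕ→ℚ m ≤ℚ ℕ→ℚ k
ℕ→ℚ-mono-≤ {m} {k} m≤k = begin
  ℕ→ℚ m                  ≡⟨ ≡-sym (ℚP.+-identityʳ (ℕ→ℚ m)) ⟩
  ℕ→ℚ m +ℚ 0ℚ            ≤⟨ ℚP.+-monoʳ-≤ (ℕ→ℚ m) (ℕ→ℚ-nonNeg (k ∸ m)) ⟩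
  ℕ→ℚ m +ℚ ℕ→ℚ (k ∸ m)   ≡⟨ ≡-sym (ℕ→ℚ-+ m (k ∸ m)) ⟩
  ℕ→ℚ (m + (k ∸ m))      ≡⟨ cong ℕ→ℚ (ℕP.m+[n∸m]≡n m≤k) ⟩
  ℕ→ℚ k                  ∎
  where open ℚP.≤-Reasoning

proportion-≤ : ∀ β k → β ≤ℚ 1ℚ → β * ℕ→ℚ k ≤ℚ ℕ→ℚ k
proportion-≤ β k β≤1 = begin
  β * ℕ→ℚ k   ≤⟨ ℚP.*-monoʳ-≤-nonNeg (ℕ→ℚ k) {{ℚP.normalize-nonNeg k 1}} β≤1 ⟩
  1ℚ * ℕ→ℚ k  ≡⟨ ℚP.*-identityˡ (ℕ→ℚ k) ⟩
  ℕ→ℚ k       ∎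
  where open ℚP.≤-Reasoning

complement-≤1 : ∀ α → 0ℚ < α → 1ℚ - α ≤ℚ 1ℚ
complement-≤1 α 0<α = ℚP.+-monoʳ-≤ 1ℚ (ℚP.neg-antimono-≤ (ℚP.<⇒≤ 0<α))

complement-* : ∀ α x → (1ℚ - α) * x ≡ x - α * x
complement-* α x = begin
  (1ℚ - α) * x           ≡⟨ ℚP.*-distribʳ-+ x 1ℚ (- α) ⟩
  1ℚ * x +ℚ (- α) * x    ≡⟨ cong₂ _+ℚ_ (ℚP.*-identityˡ x) (≡-sym (ℚP.neg-distribˡ-* α x)) ⟩
  x - α * x              ∎
  where open ≡-Reasoning

remainder-≤ : ∀ x y p s → p < y → x ≤ℚ p +ℚ s → x - y ≤ℚ s
remainder-≤ x y p s p<y x≤p+s = begin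
  x - y                 ≤⟨ ℚP.+-monoˡ-≤ (- y) x≤p+s ⟩
  (p +ℚ s) - y          ≡⟨ cong (_- y) (ℚP.+-comm p s) ⟩
  (s +ℚ p) - y          ≡⟨ ℚP.+-assoc s p (- y) ⟩
  s +ℚ (p - y)          ≤⟨ ℚP.+-monoʳ-≤ s (ℚP.<⇒≤ p-y<0) ⟩
  s +ℚ 0ℚ               ≡⟨ ℚP.+-identityʳ s ⟩
  s                     ∎
  where
  open ℚP.≤-Reasoning
  p-y<0 : p - y < 0ℚ
  p-y<0 = ℚP.<-≤-trans (ℚP.+-monoˡ-< (- y) p<y) (ℚP.≤-reflexive (ℚP.+-inverseʳ y))

prefix : ∀ {n} → ℕ → Subset n → Subset n
prefix zero    p       = ⊥
prefix (suc j) []      = []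
prefix (suc j) (x ∷ p) = x ∷ prefix j p

suffix : ∀ {n} → ℕ → Subset n → Subset n
suffix zero    p       = p
suffix (suc j) []      = []
suffix (suc j) (x ∷ p) = outside ∷ suffix j p

prefix-all : ∀ {n} (p : Subset n) → prefix n p ≡ p
prefix-all []      = refl
prefix-all (x ∷ p) = cong (x ∷_) (prefix-all p)

prefix-or-suffix : ∀ {n} j (p : Subset n) {v} → v ∈ p → v ∈ prefix j p ⊎ v ∈ suffix j p
prefix-or-suffix zero    p       v∈p         = inj₂ v∈p
prefix-or-suffix (suc j) (x ∷ p) here        = inj₁ here
prefix-or-suffix (suc j) (x ∷ p) (there v∈p) = Sum.map there there (prefix-or-suffix j p v∈p)

∣prefix∣+∣suffix∣ : ∀ {n} j (p : Subset n) → ∣ prefix j p ∣ + ∣ suffix j p ∣ ≡ ∣ p ∣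
∣prefix∣+∣suffix∣ {n} zero p rewrite ∣⊥∣≡0 n = refl
∣prefix∣+∣suffix∣ (suc j) []            = refl
∣prefix∣+∣suffix∣ (suc j) (outside ∷ p) = ∣prefix∣+∣suffix∣ j p
∣prefix∣+∣suffix∣ (suc j) (inside ∷ p)  = cong suc (∣prefix∣+∣suffix∣ j p)

∣prefix-suc∣ : ∀ {n} j (p : Subset n) → ∣ prefix (suc j) p ∣ ≤ suc ∣ prefix j p ∣
∣prefix-suc∣ j [] = z≤n
∣prefix-suc∣ {suc n} zero (outside ∷ p) rewrite ∣⊥∣≡0 n = z≤n
∣prefix-suc∣ {suc n} zero (inside ∷ p)  rewrite ∣⊥∣≡0 n = s≤s z≤n
∣prefix-suc∣ (suc j) (outside ∷ p) = ∣prefix-suc∣ j p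
∣prefix-suc∣ (suc j) (inside ∷ p)  = s≤s (∣prefix-suc∣ j p)

∣p∪q∣≤∣p∣+∣q∣ : ∀ {n} (p q : Subset n) → ∣ p ∪ q ∣ ≤ ∣ p ∣ + ∣ q ∣
∣p∪q∣≤∣p∣+∣q∣ []            []           = z≤n
∣p∪q∣≤∣p∣+∣q∣ (inside ∷ p)  (t ∷ q)      =
  s≤s (ℕP.≤-trans (∣p∪q∣≤∣p∣+∣q∣ p q) (ℕP.+-monoʳ-≤ ∣ p ∣ (∣p∣≤∣x∷p∣ t q)))
∣p∪q∣≤∣p∣+∣q∣ (outside ∷ p) (inside ∷ q) =
  ℕP.≤-trans (s≤s (∣p∪q∣≤∣p∣+∣q∣ p q)) (ℕP.≤-reflexive (≡-sym (ℕP.+-suc ∣ p ∣ ∣ q ∣)))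
∣p∪q∣≤∣p∣+∣q∣ (outside ∷ p) (outside ∷ q) = ∣p∪q∣≤∣p∣+∣q∣ p q

covering-size : ∀ {n} (p q : Subset n) → (∀ v → v ∈ p ⊎ v ∈ q) → n ≤ ∣ p ∣ + ∣ q ∣
covering-size {n} p q covers = begin
  n          ≡⟨ ≡-sym (∣⊤∣≡n n) ⟩
  ∣ ⊤ {n} ∣  ≤⟨ p⊆q⇒∣p∣≤∣q∣ {p = ⊤} {q = p ∪ q} (λ {v} _ → x∈p∪q⁺ (covers v)) ⟩
  ∣ p ∪ q ∣  ≤⟨ ∣p∪q∣≤∣p∣+∣q∣ p q ⟩
  (∣ p ∣) + (∣ q ∣) ∎
  where open ℕP.≤-Reasoning

first-crossing : ∀ {P : ℕ → Set} → (∀ j → Dec (P j)) →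
                 ∀ m → P m → P 0 ⊎ ∃ λ j → ¬ P j × P (suc j)
first-crossing P? zero    Pm = inj₁ Pm
first-crossing P? (suc m) Pm with P? m
... | yes Pm-1 = first-crossing P? m Pm-1
... | no ¬Pm-1 = inj₂ (m , ¬Pm-1 , Pm)

module _ {n : ℕ} (G : Graph n) where

  inClosedNbhd? : ∀ S v → Dec (InClosedNbhd G S v)
  inClosedNbhd? S v = (v ∈? S) ⊎-dec any? (λ u → (u ∈? S) ×-dec T? (adj G u v))

  nbhd : Subset n → Subset n
  nbhd S = tabulate (λ v → does (inClosedNbhd? S v))

  nbhd-correct : ∀ S → IsClosedNbhd G S (nbhd S)
  nbhd-correct S v =
    (λ v∈N → toWitness {a? = inClosedNbhd? S v} (Equivalence.from T-≡
      (trans (isYes≗does _) (trans (≡-sym lookup-nbhd) ([]=⇒lookup v∈N))))) ,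
    (λ inN → lookup⇒[]= v (nbhd S) (trans lookup-nbhd (dec-true (inClosedNbhd? S v) inN)))
    where
    lookup-nbhd : lookup (nbhd S) v ≡ does (inClosedNbhd? S v)
    lookup-nbhd = lookup∘tabulate (λ w → does (inClosedNbhd? S w)) v

  nbhd⁺ : ∀ S {v} → InClosedNbhd G S v → v ∈ nbhd S
  nbhd⁺ S {v} = proj₂ (nbhd-correct S v)

  reaches : ℚ → Subset n → Set
  reaches α S = α * ℕ→ℚ n ≤ℚ ℕ→ℚ ∣ nbhd S ∣

  reaches⇒partialDom : ∀ α S → reaches α S → IsPartialDom α G S
  reaches⇒partialDom α S r = nbhd S , nbhd-correct S , r

  nbhd-split : ∀ {S A B} → (∀ {u} → u ∈ S → u ∈ A ⊎ u ∈ B) →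
               ∀ {v} → InClosedNbhd G S v → v ∈ nbhd A ⊎ v ∈ nbhd B
  nbhd-split split (inj₁ v∈S) =
    Sum.map (λ v∈A → nbhd⁺ _ (inj₁ v∈A)) (λ v∈B → nbhd⁺ _ (inj₁ v∈B)) (split v∈S)
  nbhd-split split (inj₂ (u , u∈S , u~v)) =
    Sum.map (λ u∈A → nbhd⁺ _ (inj₂ (u , u∈A , u~v))) (λ u∈B → nbhd⁺ _ (inj₂ (u , u∈B , u~v)))
            (split u∈S)

  dominating⇒reaches : ∀ β {D} → β ≤ℚ 1ℚ → IsDominating G D → reaches β D
  dominating⇒reaches β {D} β≤1 dom = ℚP.≤-trans (proportion-≤ β n β≤1) (ℕ→ℚ-mono-≤ full)
    where
    full : n ≤ ∣ nbhd D ∣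
    full = ℕP.≤-trans (ℕP.≤-reflexive (≡-sym (∣⊤∣≡n n)))
                      (p⊆q⇒∣p∣≤∣q∣ {p = ⊤} {q = nbhd D} (λ {v} _ → nbhd⁺ D (dom v)))

  suffix-reaches : ∀ α {D} j → IsDominating G D → ¬ reaches α (prefix j D) →
                   reaches (1ℚ - α) (suffix j D)
  suffix-reaches α {D} j dom short =
    subst (_≤ℚ ℕ→ℚ ∣ nbhd (suffix j D) ∣) (≡-sym (complement-* α (ℕ→ℚ n)))
      (remainder-≤ (ℕ→ℚ n) (α * ℕ→ℚ n) (ℕ→ℚ ∣ N-pre ∣) (ℕ→ℚ ∣ N-suf ∣) (ℚP.≰⇒> short)
        (ℚP.≤-trans (ℕ→ℚ-mono-≤ (covering-size N-pre N-suf covers))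
                    (ℚP.≤-reflexive (ℕ→ℚ-+ ∣ N-pre ∣ ∣ N-suf ∣))))
    where
    N-pre N-suf : Subset n
    N-pre = nbhd (prefix j D)
    N-suf = nbhd (suffix j D)
    covers : ∀ v → v ∈ N-pre ⊎ v ∈ N-suf
    covers v = nbhd-split (prefix-or-suffix j D) (dom v)

  PartialDomPair : ℚ → ℕ → Set
  PartialDomPair α k =
    ∃₂ λ A B → IsPartialDom α G A × IsPartialDom (1ℚ - α) G B × (∣ A ∣) + (∣ B ∣) ≤ k

  partialDom-split : ∀ α → 0ℚ < α → α < 1ℚ → ∀ {D} → IsDominating G D →
                     PartialDomPair α (∣ D ∣ + 1)
  partialDom-split α 0<α α<1 {D} dom =
    [ from-empty , (λ (j , short , enough) → from-crossing j short enough) ]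
      (first-crossing {P = λ j → reaches α (prefix j D)}
                      (λ j → α * ℕ→ℚ n ≤ℚ? ℕ→ℚ ∣ nbhd (prefix j D) ∣) n
        (subst (reaches α) (≡-sym (prefix-all D)) (dominating⇒reaches α (ℚP.<⇒≤ α<1) dom)))
    where
    from-empty : reaches α (prefix 0 D) → PartialDomPair α (∣ D ∣ + 1)
    from-empty r = prefix 0 D , D , reaches⇒partialDom α _ r ,
      reaches⇒partialDom (1ℚ - α) D (dominating⇒reaches (1ℚ - α) (complement-≤1 α 0<α) dom) ,
      ℕP.≤-trans (ℕP.≤-reflexive (cong (_+ ∣ D ∣) (∣⊥∣≡0 n))) (ℕP.m≤m+n ∣ D ∣ 1)

    from-crossing : ∀ j → ¬ reaches α (prefix j D) → reaches α (prefix (suc j) D) →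
                    PartialDomPair α (∣ D ∣ + 1)
    from-crossing j short enough = prefix (suc j) D , suffix j D ,
      reaches⇒partialDom α _ enough ,
      reaches⇒partialDom (1ℚ - α) _ (suffix-reaches α j dom short) ,
      (begin
        (∣ prefix (suc j) D ∣) + (∣ suffix j D ∣)   ≤⟨ ℕP.+-monoˡ-≤ (∣ suffix j D ∣) (∣prefix-suc∣ j D) ⟩
        suc ((∣ prefix j D ∣) + (∣ suffix j D ∣))   ≡⟨ cong suc (∣prefix∣+∣suffix∣ j D) ⟩
        suc (∣ D ∣)                                 ≡⟨ ℕP.+-comm 1 (∣ D ∣) ⟩
        (∣ D ∣) + 1                                 ∎)
      where open ℕP.≤-Reasoning

mainTheorem8 : (n : ℕ) (G : Graph n) (α : ℚ) → 0ℚ < α → α < 1ℚ →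
    (a b g : ℕ) → IsPd α G a → IsPd (1ℚ - α) G b → IsDomNumber G g →
    a + b ≤ g + 1
mainTheorem8 n G α 0<α α<1 a b g (_ , minimalA) (_ , minimalB) ((D , dom , ∣D∣≡g) , _) =
  bound (partialDom-split G α 0<α α<1 dom)
  where
  bound : PartialDomPair G α (∣ D ∣ + 1) → a + b ≤ g + 1
  bound (A , B , pdA , pdB , small) = begin
    a + b              ≤⟨ ℕP.+-mono-≤ (minimalA A pdA) (minimalB B pdB) ⟩
    (∣ A ∣) + (∣ B ∣)  ≤⟨ small ⟩
    (∣ D ∣) + 1        ≡⟨ cong (_+ 1) ∣D∣≡g ⟩
    g + 1              ∎
    where open ℕP.≤-Reasoning
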